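{- For every odd integer $n \ge 13$, we have $\chi'_{st}(C_4 \,\square\, C_n) \le 7$.
   Context: A star edge-coloring of a graph $G$ is a proper edge-coloring of $G$ in which there is no bichromatic path and no bichromatic cycle of length four (i.e., with four edges). The star chromatic index $\chi'_{st}(G)$ is the minimum number of colors in a star edge-coloring of $G$. $C_m$ denotes the cycle on $m$ vertices. $G \,\square\, H$ denotes the Cartesian product: vertex set $V(G)\times V(H)$, with $(u,v)(u',v')$ an edge iff either $uu'\in E(G)$ and $v=v'$, or $u=u'$ and $vv'\in E(H)$. -}

module Defs where

open import Level using (0ℓ)
open import Data.Nat using (ℕ; suc; _%_; NonZero)
open import Data.Fin using (Fin; toℕ)
open import Data.Product using (_×_; _,_; Σ)
open import Data.Sum using (_⊎_)
open import Relation.Binary.PropositionalEquality using (_≡_; _≢_)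

record Graph : Set₁ where
  field
    V   : Set
    Adj : V → V → Set
open Graph public

CycleAdj : (m : ℕ) → .{{NonZero m}} → Fin m → Fin m → Set
CycleAdj m i j = (toℕ j ≡ suc (toℕ i) % m) ⊎ (toℕ i ≡ suc (toℕ j) % m)

C : (m : ℕ) → .{{NonZero m}} → Graph
C m = record { V = Fin m ; Adj = CycleAdj m }

_□_ : Graph → Graph → Graph
G □ H = record
  { V   = V G × V H
  ; Adj = λ { (u , v) (u' , v') → (Adj G u u' × v ≡ v') ⊎ (u ≡ u' × Adj H v v') } }

-- An edge-colouring with k colours: a colour for each (unordered) edge,
-- represented by a function on ordered pairs that is symmetric on edges
-- (its values on non-adjacent pairs are irrelevant).
record EdgeColouring (G : Graph) (k : ℕ) : Set where
  field
    col : V G → V G → Fin k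
    sym : ∀ x y → Adj G x y → col x y ≡ col y x
open EdgeColouring public

IsProper : {G : Graph} {k : ℕ} → EdgeColouring G k → Set
IsProper {G} c = ∀ x y z → Adj G x y → Adj G x z → y ≢ z → col c x y ≢ col c x z

-- No bichromatic path or cycle with four edges: there is no walk
-- v0 v1 v2 v3 v4 with v0,v1,v2,v3 pairwise distinct and v1,v2,v3,v4 pairwise
-- distinct (so either a path on 5 vertices, or a 4-cycle when v4 = v0) whose
-- edge colours alternate a,b,a,b.
NoBichromatic4 : {G : Graph} {k : ℕ} → EdgeColouring G k → Set
NoBichromatic4 {G} c =
  ∀ v0 v1 v2 v3 v4 →
  Adj G v0 v1 → Adj G v1 v2 → Adj G v2 v3 → Adj G v3 v4 →
  v0 ≢ v1 → v0 ≢ v2 → v0 ≢ v3 → v1 ≢ v2 → v1 ≢ v3 → v2 ≢ v3 →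
  v1 ≢ v4 → v2 ≢ v4 → v3 ≢ v4 →
  col c v0 v1 ≡ col c v2 v3 → col c v1 v2 ≡ col c v3 v4 → Data.Empty.⊥
  where import Data.Empty

IsStarEdgeColouring : {G : Graph} {k : ℕ} → EdgeColouring G k → Set
IsStarEdgeColouring c = IsProper c × NoBichromatic4 c

StarChromaticIndex≤ : Graph → ℕ → Set
StarChromaticIndex≤ G k = Σ (EdgeColouring G k) IsStarEdgeColouring

-- Colour C₄ □ Cₙ column by column: column i receives one of nine column types, which fixes the
-- colours of its four vertical edges and of the four horizontal edges towards column i + 1.
-- Consecutive types must follow a small automaton made of a 4-cycle A = (0 1 2 3) and a 5-cycle
-- B = (4 5 6 7 8), each of which can be left for the other, so the closed walks B Aᵃ and B³ Aᵃ
-- give column words of every length 5 + 4a and 15 + 4a, i.e. of every odd length ≥ 13.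
-- A bichromatic path or 4-cycle with four edges stays within the five columns around its middle
-- vertex, so the star condition is local; it then reduces to a finite check of the windows of five
-- consecutive types along walks of the automaton, which is decided by evaluation.

module Submission where

open import Data.Bool using (true; false; if_then_else_)
open import Data.Empty using (⊥; ⊥-elim)
open import Data.Fin using (Fin; zero; suc; toℕ; #_; _≟_; inject₁)
open import Data.Fin.Properties using (toℕ-fromℕ<; toℕ-injective; toℕ<n; all?)
open import Data.Nat using (ℕ; zero; suc; pred; _+_; _*_; _%_; _/_; _≤_; _≤ᵇ_; _<?_; NonZero; s≤s; z≤n)
open import Data.Nat.DivMod
  using (_mod_; %-distribˡ-+; m%n%n≡m%n; m≡m%n+[m/n]*n; %-remove-+ˡ; m<n⇒m%n≡m; n%n≡0)
open import Data.Nat.Divisibility using (_∣_; divides; ∣-refl; ∣⇒≤)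
open import Data.Nat.Properties
  using (+-suc; +-comm; +-cancelʳ-≡; suc-pred; <⇒≱; ≤-antisym; ≮⇒≥; suc-injective; ≤-trans; ≤⇒≤ᵇ;
         m≤n+m; m≤n⇒m≤o+n; m≤n⇒∃[o]m+o≡n)
open import Data.Product using (_×_; _,_; Σ; ∃; proj₁; proj₂)
open import Data.Product.Properties using (≡-dec)
open import Data.Sum using (_⊎_; inj₁; inj₂)
open import Data.Vec using (Vec; []; _∷_; lookup)
open import Function using (_∘_)
open import Relation.Binary.Definitions using (DecidableEquality)
open import Relation.Binary.PropositionalEquality
open import Relation.Nullary using (Dec; yes; no; ¬?)
open import Relation.Nullary.Decidable using (_→-dec_; _×-dec_; _⊎-dec_; toWitness)

open import Defs hiding (sym)

module _ (m : ℕ) .{{_ : NonZero m}} where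

  next prev : Fin m → Fin m
  next i = suc (toℕ i) mod m
  prev i = (pred m + toℕ i) mod m

  toℕ-next : ∀ i → toℕ (next i) ≡ suc (toℕ i) % m
  toℕ-next i = toℕ-fromℕ< _

  toℕ-prev : ∀ i → toℕ (prev i) ≡ (pred m + toℕ i) % m
  toℕ-prev i = toℕ-fromℕ< _

  [k+a%m]%m≡[k+a]%m : ∀ k a → (k + a % m) % m ≡ (k + a) % m
  [k+a%m]%m≡[k+a]%m k a = begin
    (k + a % m) % m         ≡⟨ %-distribˡ-+ k (a % m) m ⟩
    (k % m + a % m % m) % m ≡⟨ cong (λ r → (k % m + r) % m) (m%n%n≡m%n a m) ⟩
    (k % m + a % m) % m     ≡⟨ %-distribˡ-+ k a m ⟨
    (k + a) % m             ∎
    where open ≡-Reasoning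

  private
    [1+pred[m]+i]%m≡i : ∀ i → (suc (pred m) + toℕ i) % m ≡ toℕ i
    [1+pred[m]+i]%m≡i i = begin
      (suc (pred m) + toℕ i) % m ≡⟨ cong (λ k → (k + toℕ i) % m) (suc-pred m) ⟩
      (m + toℕ i) % m            ≡⟨ %-remove-+ˡ (toℕ i) ∣-refl ⟩
      toℕ i % m                  ≡⟨ m<n⇒m%n≡m (toℕ<n i) ⟩
      toℕ i                      ∎
      where open ≡-Reasoning

  prev-next : ∀ i → prev (next i) ≡ i
  prev-next i = toℕ-injective (begin
    toℕ (prev (next i))                ≡⟨ toℕ-prev (next i) ⟩
    (pred m + toℕ (next i)) % m        ≡⟨ cong (λ r → (pred m + r) % m) (toℕ-next i) ⟩
    (pred m + suc (toℕ i) % m) % m     ≡⟨ [k+a%m]%m≡[k+a]%m (pred m) (suc (toℕ i)) ⟩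
    (pred m + suc (toℕ i)) % m         ≡⟨ cong (_% m) (+-suc (pred m) (toℕ i)) ⟩
    (suc (pred m) + toℕ i) % m         ≡⟨ [1+pred[m]+i]%m≡i i ⟩
    toℕ i                              ∎)
    where open ≡-Reasoning

  next-prev : ∀ i → next (prev i) ≡ i
  next-prev i = toℕ-injective (begin
    toℕ (next (prev i))                ≡⟨ toℕ-next (prev i) ⟩
    suc (toℕ (prev i)) % m             ≡⟨ cong (λ r → suc r % m) (toℕ-prev i) ⟩
    (1 + (pred m + toℕ i) % m) % m     ≡⟨ [k+a%m]%m≡[k+a]%m 1 (pred m + toℕ i) ⟩
    (suc (pred m) + toℕ i) % m         ≡⟨ [1+pred[m]+i]%m≡i i ⟩
    toℕ i                              ∎)
    where open ≡-Reasoning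

  [k+t]%m≡t⇒m∣k : ∀ k t → (k + t) % m ≡ t → m ∣ k
  [k+t]%m≡t⇒m∣k k t eq = divides ((k + t) / m) (+-cancelʳ-≡ t k _ (begin
    k + t                          ≡⟨ m≡m%n+[m/n]*n (k + t) m ⟩
    (k + t) % m + (k + t) / m * m  ≡⟨ cong (_+ (k + t) / m * m) eq ⟩
    t + (k + t) / m * m            ≡⟨ +-comm t _ ⟩
    (k + t) / m * m + t            ∎))
    where open ≡-Reasoning

  next≢id : 2 ≤ m → ∀ i → next i ≢ i
  next≢id 2≤m i eq =
    <⇒≱ 2≤m (∣⇒≤ ([k+t]%m≡t⇒m∣k 1 (toℕ i) (trans (sym (toℕ-next i)) (cong toℕ eq))))

  next²≢id : 3 ≤ m → ∀ i → next (next i) ≢ i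
  next²≢id 3≤m i eq = <⇒≱ 3≤m (∣⇒≤ ([k+t]%m≡t⇒m∣k 2 (toℕ i) (begin
    (2 + toℕ i) % m             ≡⟨ [k+a%m]%m≡[k+a]%m 1 (suc (toℕ i)) ⟨
    suc (suc (toℕ i) % m) % m   ≡⟨ cong (λ r → suc r % m) (toℕ-next i) ⟨
    suc (toℕ (next i)) % m      ≡⟨ toℕ-next (next i) ⟨
    toℕ (next (next i))         ≡⟨ cong toℕ eq ⟩
    toℕ i                       ∎)))
    where open ≡-Reasoning

  prev≢id : 2 ≤ m → ∀ i → prev i ≢ i
  prev≢id 2≤m i eq = next≢id 2≤m i (trans (cong next (sym eq)) (next-prev i))

  prev≢next : 3 ≤ m → ∀ i → prev i ≢ next i
  prev≢next 3≤m i eq = next²≢id 3≤m (prev i) (trans (cong next (next-prev i)) (sym eq))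

  cycleAdj⇒next⊎prev : ∀ {i j} → CycleAdj m i j → j ≡ next i ⊎ j ≡ prev i
  cycleAdj⇒next⊎prev {i} {j} (inj₁ eq) = inj₁ (toℕ-injective (trans eq (sym (toℕ-next i))))
  cycleAdj⇒next⊎prev {i} {j} (inj₂ eq) = inj₂ (begin
    j               ≡⟨ prev-next j ⟨
    prev (next j)   ≡⟨ cong prev (toℕ-injective (trans (toℕ-next j) (sym eq))) ⟩
    prev i          ∎)
    where open ≡-Reasoning

Dir : Set
Dir = Fin 4

pattern up    = zero
pattern down  = suc zero
pattern right = suc (suc zero)
pattern left  = suc (suc (suc zero))

reverse : Dir → Dir
reverse up    = down
reverse down  = up
reverse right = left
reverse left  = right

NotBichromatic : {A C : Set} (v0 v1 v2 v3 v4 : A) (c01 c12 c23 c34 : C) → Set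
NotBichromatic v0 v1 v2 v3 v4 c01 c12 c23 c34 =
  v0 ≢ v1 → v0 ≢ v2 → v0 ≢ v3 → v1 ≢ v2 → v1 ≢ v3 → v2 ≢ v3 →
  v1 ≢ v4 → v2 ≢ v4 → v3 ≢ v4 → c01 ≡ c23 → c12 ≡ c34 → ⊥

notBichromatic? : {A C : Set} → DecidableEquality A → DecidableEquality C →
  ∀ v0 v1 v2 v3 v4 c01 c12 c23 c34 → Dec (NotBichromatic v0 v1 v2 v3 v4 c01 c12 c23 c34)
notBichromatic? _≟A_ _≟C_ v0 v1 v2 v3 v4 c01 c12 c23 c34 =
  ¬? (v0 ≟A v1) →-dec ¬? (v0 ≟A v2) →-dec ¬? (v0 ≟A v3) →-dec ¬? (v1 ≟A v2) →-dec
  ¬? (v1 ≟A v3) →-dec ¬? (v2 ≟A v3) →-dec ¬? (v1 ≟A v4) →-dec ¬? (v2 ≟A v4) →-dec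
  ¬? (v3 ≟A v4) →-dec (c01 ≟C c23) →-dec (c12 ≟C c34) →-dec no (λ ())

module Local {X : Set} {k : ℕ} (move : Dir → X → X) (colourOf : Dir → X → Fin k) where

  ProperAt : X → Set
  ProperAt x = ∀ d e → d ≢ e → colourOf d x ≢ colourOf e x

  NoBichromatic4Through : X → Set
  NoBichromatic4Through x = ∀ d1 d0 d3 d4 →
    NotBichromatic (move d0 (move d1 x)) (move d1 x) x (move d3 x) (move d4 (move d3 x))
      (colourOf d0 (move d1 x)) (colourOf d1 x) (colourOf d3 x) (colourOf d4 (move d3 x))

  StarAt : X → Set
  StarAt x = ProperAt x × NoBichromatic4Through x

  starAt? : DecidableEquality X → ∀ x → Dec (StarAt x)
  starAt? _≟X_ x =
    all? (λ d → all? λ e → ¬? (d ≟ e) →-dec ¬? (colourOf d x ≟ colourOf e x)) ×-dec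
    all? (λ d1 → all? λ d0 → all? λ d3 → all? λ d4 → notBichromatic? _≟X_ _≟_ _ _ _ _ _ _ _ _ _)

module _ {X Y : Set} {k : ℕ}
         {moveX : Dir → X → X} {colourX : Dir → X → Fin k}
         {moveY : Dir → Y → Y} {colourY : Dir → Y → Fin k}
         (f : Y → X) (y : Y)
         (move-f        : ∀ d → moveX d (f y) ≡ f (moveY d y))
         (move²-f       : ∀ d e → moveX e (moveX d (f y)) ≡ f (moveY e (moveY d y)))
         (colour-f      : ∀ d → colourX d (f y) ≡ colourY d y)
         (colour-move-f : ∀ d e → colourX e (moveX d (f y)) ≡ colourY e (moveY d y))
         where

  private
    distinct : ∀ {v u s t} → v ≡ f s → u ≡ f t → v ≢ u → s ≢ t
    distinct refl refl v≢u s≡t = v≢u (cong f s≡t)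

  starAt-transfer : Local.StarAt moveY colourY y → Local.StarAt moveX colourX (f y)
  starAt-transfer (proper , noBichromatic) =
    (λ d e d≢e eq → proper d e d≢e (trans (sym (colour-f d)) (trans eq (colour-f e)))) ,
    λ d1 d0 d3 d4 n01 n02 n03 n12 n13 n23 n14 n24 n34 e1 e2 →
      noBichromatic d1 d0 d3 d4
        (distinct (move²-f d1 d0) (move-f d1) n01) (distinct (move²-f d1 d0) refl n02)
        (distinct (move²-f d1 d0) (move-f d3) n03) (distinct (move-f d1) refl n12)
        (distinct (move-f d1) (move-f d3) n13) (distinct refl (move-f d3) n23)
        (distinct (move-f d1) (move²-f d3 d4) n14) (distinct refl (move²-f d3 d4) n24)
        (distinct (move-f d3) (move²-f d3 d4) n34)
        (trans (sym (colour-move-f d1 d0)) (trans e1 (colour-f d3)))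
        (trans (sym (colour-f d1)) (trans e2 (colour-move-f d3 d4)))

ColumnType : Set
ColumnType = Fin 9

verticalColours horizontalColours : Vec (Vec (Fin 7) 4) 9
verticalColours =
  (# 6 ∷ # 3 ∷ # 4 ∷ # 3 ∷ []) ∷
  (# 4 ∷ # 6 ∷ # 3 ∷ # 6 ∷ []) ∷
  (# 3 ∷ # 0 ∷ # 6 ∷ # 5 ∷ []) ∷
  (# 4 ∷ # 5 ∷ # 6 ∷ # 0 ∷ []) ∷
  (# 6 ∷ # 4 ∷ # 3 ∷ # 5 ∷ []) ∷
  (# 4 ∷ # 3 ∷ # 5 ∷ # 0 ∷ []) ∷
  (# 0 ∷ # 4 ∷ # 3 ∷ # 2 ∷ []) ∷
  (# 5 ∷ # 6 ∷ # 4 ∷ # 3 ∷ []) ∷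
  (# 6 ∷ # 4 ∷ # 3 ∷ # 5 ∷ []) ∷
  []
horizontalColours =
  (# 0 ∷ # 5 ∷ # 0 ∷ # 5 ∷ []) ∷
  (# 2 ∷ # 1 ∷ # 2 ∷ # 1 ∷ []) ∷
  (# 6 ∷ # 6 ∷ # 4 ∷ # 3 ∷ []) ∷
  (# 1 ∷ # 2 ∷ # 1 ∷ # 2 ∷ []) ∷
  (# 3 ∷ # 5 ∷ # 0 ∷ # 4 ∷ []) ∷
  (# 6 ∷ # 1 ∷ # 6 ∷ # 1 ∷ []) ∷
  (# 1 ∷ # 3 ∷ # 2 ∷ # 0 ∷ []) ∷
  (# 4 ∷ # 0 ∷ # 5 ∷ # 6 ∷ []) ∷
  (# 1 ∷ # 2 ∷ # 1 ∷ # 2 ∷ []) ∷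
  []

vertical horizontal : ColumnType → Fin 4 → Fin 7
vertical x r = lookup (lookup verticalColours x) r
horizontal x r = lookup (lookup horizontalColours x) r

module Torus (m : ℕ) .{{_ : NonZero m}} where

  Vertex : Set
  Vertex = Fin 4 × Fin m

  _≟V_ : DecidableEquality Vertex
  _≟V_ = ≡-dec _≟_ _≟_

  move : Dir → Vertex → Vertex
  move up    (r , i) = (next 4 r , i)
  move down  (r , i) = (prev 4 r , i)
  move right (r , i) = (r , next m i)
  move left  (r , i) = (r , prev m i)

  move-reverse : ∀ d x → move (reverse d) (move d x) ≡ x
  move-reverse up    (r , i) = cong (_, i) (prev-next 4 r)
  move-reverse down  (r , i) = cong (_, i) (next-prev 4 r)
  move-reverse right (r , i) = cong (r ,_) (prev-next m i)
  move-reverse left  (r , i) = cong (r ,_) (next-prev m i)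

  adj⇒move : ∀ {x y} → Adj (C 4 □ C m) x y → ∃ λ d → y ≡ move d x
  adj⇒move {r , i} (inj₁ (adj , refl)) with cycleAdj⇒next⊎prev 4 adj
  ... | inj₁ refl = up , refl
  ... | inj₂ refl = down , refl
  adj⇒move {r , i} (inj₂ (refl , adj)) with cycleAdj⇒next⊎prev m adj
  ... | inj₁ refl = right , refl
  ... | inj₂ refl = left , refl

  adj⇒move⁻ : ∀ {x y} → Adj (C 4 □ C m) x y → ∃ λ d → x ≡ move d y
  adj⇒move⁻ {x} adj with adj⇒move adj
  ... | d , refl = reverse d , sym (move-reverse d x)

  module _ (3≤m : 3 ≤ m) where

    private
      2≤4 : 2 ≤ 4
      2≤4 = s≤s (s≤s z≤n)

      3≤4 : 3 ≤ 4
      3≤4 = s≤s (s≤s (s≤s z≤n))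

    move-injectiveˡ : ∀ {d e} x → move d x ≡ move e x → d ≡ e
    move-injectiveˡ {up}    {up}    _ _  = refl
    move-injectiveˡ {up}    {down}  (r , i) eq = ⊥-elim (prev≢next 4 3≤4 r (sym (cong proj₁ eq)))
    move-injectiveˡ {up}    {right} (r , i) eq = ⊥-elim (next≢id 4 2≤4 r (cong proj₁ eq))
    move-injectiveˡ {up}    {left}  (r , i) eq = ⊥-elim (next≢id 4 2≤4 r (cong proj₁ eq))
    move-injectiveˡ {down}  {up}    (r , i) eq = ⊥-elim (prev≢next 4 3≤4 r (cong proj₁ eq))
    move-injectiveˡ {down}  {down}  _ _  = refl
    move-injectiveˡ {down}  {right} (r , i) eq = ⊥-elim (prev≢id 4 2≤4 r (cong proj₁ eq))
    move-injectiveˡ {down}  {left}  (r , i) eq = ⊥-elim (prev≢id 4 2≤4 r (cong proj₁ eq))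
    move-injectiveˡ {right} {up}    (r , i) eq = ⊥-elim (next≢id 4 2≤4 r (sym (cong proj₁ eq)))
    move-injectiveˡ {right} {down}  (r , i) eq = ⊥-elim (prev≢id 4 2≤4 r (sym (cong proj₁ eq)))
    move-injectiveˡ {right} {right} _ _  = refl
    move-injectiveˡ {right} {left}  (r , i) eq = ⊥-elim (prev≢next m 3≤m i (sym (cong proj₂ eq)))
    move-injectiveˡ {left}  {up}    (r , i) eq = ⊥-elim (next≢id 4 2≤4 r (sym (cong proj₁ eq)))
    move-injectiveˡ {left}  {down}  (r , i) eq = ⊥-elim (prev≢id 4 2≤4 r (sym (cong proj₁ eq)))
    move-injectiveˡ {left}  {right} (r , i) eq = ⊥-elim (prev≢next m 3≤m i (cong proj₂ eq))
    move-injectiveˡ {left}  {left}  _ _  = refl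

    direction : Vertex → Vertex → Dir
    direction x y with y ≟V move up x | y ≟V move down x | y ≟V move right x
    ... | yes _ | _     | _     = up
    ... | no _  | yes _ | _     = down
    ... | no _  | no _  | yes _ = right
    ... | no _  | no _  | no _  = left

    direction-move : ∀ d x → direction x (move d x) ≡ d
    direction-move d x with move d x ≟V move up x | move d x ≟V move down x | move d x ≟V move right x
    ... | yes eq | _      | _      = sym (move-injectiveˡ x eq)
    ... | no _   | yes eq | _      = sym (move-injectiveˡ x eq)
    ... | no _   | no _   | yes eq = sym (move-injectiveˡ x eq)
    direction-move up    x | no ≢up | no _     | no _      = ⊥-elim (≢up refl)
    direction-move down  x | no _   | no ≢down | no _      = ⊥-elim (≢down refl)
    direction-move right x | no _   | no _     | no ≢right = ⊥-elim (≢right refl)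
    direction-move left  x | no _   | no _     | no _      = refl

  module Coloured (w : Fin m → ColumnType) where

    colourOf : Dir → Vertex → Fin 7
    colourOf up    (r , i) = vertical (w i) r
    colourOf down  (r , i) = vertical (w i) (prev 4 r)
    colourOf right (r , i) = horizontal (w i) r
    colourOf left  (r , i) = horizontal (w (prev m i)) r

    colourOf-reverse : ∀ d x → colourOf d x ≡ colourOf (reverse d) (move d x)
    colourOf-reverse up    (r , i) = cong (vertical (w i)) (sym (prev-next 4 r))
    colourOf-reverse down  (r , i) = refl
    colourOf-reverse right (r , i) = cong (λ j → horizontal (w j) r) (sym (prev-next m i))
    colourOf-reverse left  (r , i) = refl

    open Local move colourOf public

    module _ (3≤m : 3 ≤ m) where

      colour : Vertex → Vertex → Fin 7
      colour x y = colourOf (direction 3≤m x y) x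

      colour-move : ∀ d x → colour x (move d x) ≡ colourOf d x
      colour-move d x = cong (λ e → colourOf e x) (direction-move 3≤m d x)

      colour-sym : ∀ x y → Adj (C 4 □ C m) x y → colour x y ≡ colour y x
      colour-sym x y adj with adj⇒move adj
      ... | d , refl = begin
        colour x (move d x)                            ≡⟨ colour-move d x ⟩
        colourOf d x                                   ≡⟨ colourOf-reverse d x ⟩
        colourOf (reverse d) (move d x)                ≡⟨ colour-move (reverse d) (move d x) ⟨
        colour (move d x) (move (reverse d) (move d x)) ≡⟨ cong (colour (move d x)) (move-reverse d x) ⟩
        colour (move d x) x                            ∎
        where open ≡-Reasoning

      colouring : EdgeColouring (C 4 □ C m) 7
      colouring = record { col = colour ; sym = colour-sym }

      starColouring : (∀ x → StarAt x) → IsStarEdgeColouring colouring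
      starColouring star = proper , noBichromatic
        where
        proper : IsProper colouring
        proper x y z axy axz y≢z with adj⇒move axy | adj⇒move axz
        ... | d , refl | e , refl = λ eq →
          proj₁ (star x) d e (λ { refl → y≢z refl })
            (trans (sym (colour-move d x)) (trans eq (colour-move e x)))

        noBichromatic : NoBichromatic4 colouring
        noBichromatic v0 v1 v2 v3 v4 a01 a12 a23 a34 n01 n02 n03 n12 n13 n23 n14 n24 n34 e1 e2
          with adj⇒move⁻ a12 | adj⇒move⁻ a01 | adj⇒move a23 | adj⇒move a34
        ... | d1 , refl | d0 , refl | d3 , refl | d4 , refl =
          proj₂ (star v2) d1 d0 d3 d4 n01 n02 n03 n12 n13 n23 n14 n24 n34
            (begin
              colourOf d0 v1   ≡⟨ colour-move d0 v1 ⟨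
              colour v1 v0     ≡⟨ colour-sym v0 v1 a01 ⟨
              colour v0 v1     ≡⟨ e1 ⟩
              colour v2 v3     ≡⟨ colour-move d3 v2 ⟩
              colourOf d3 v2   ∎)
            (begin
              colourOf d1 v2   ≡⟨ colour-move d1 v2 ⟨
              colour v2 v1     ≡⟨ colour-sym v1 v2 a12 ⟨
              colour v1 v2     ≡⟨ e2 ⟩
              colour v3 v4     ≡⟨ colour-move d4 v3 ⟩
              colourOf d4 v3   ∎)
          where open ≡-Reasoning

module _ (m : ℕ) .{{_ : NonZero m}} where
  open Torus m

  colourOf-cong : ∀ {w w′} → (∀ i → w i ≡ w′ i) →
    ∀ d x → Coloured.colourOf w d x ≡ Coloured.colourOf w′ d x
  colourOf-cong eq up    (r , i) = cong (λ t → vertical t r) (eq i)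
  colourOf-cong eq down  (r , i) = cong (λ t → vertical t (prev 4 r)) (eq i)
  colourOf-cong eq right (r , i) = cong (λ t → horizontal t r) (eq i)
  colourOf-cong eq left  (r , i) = cong (λ t → horizontal t r) (eq (prev m i))

  starAt-cong : ∀ {w w′} → (∀ i → w i ≡ w′ i) → ∀ x → Coloured.StarAt w x → Coloured.StarAt w′ x
  starAt-cong {w} {w′} eq x =
    starAt-transfer {moveX = move} {Coloured.colourOf w′} {move} {Coloured.colourOf w} (λ v → v) x
      (λ _ → refl) (λ _ _ → refl) (λ d → colourOf-cong eq′ d x) (λ d e → colourOf-cong eq′ e (move d x))
    where
    eq′ : ∀ i → w′ i ≡ w i
    eq′ i = sym (eq i)

-- Both cycles A = (0 1 2 3) and B = (4 5 6 7 8) are walks, and from 3 and from 8 a walk may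
-- enter either cycle.
stepA stepB : ColumnType → ColumnType
stepA x = lookup (# 1 ∷ # 2 ∷ # 3 ∷ # 0 ∷ # 5 ∷ # 6 ∷ # 7 ∷ # 8 ∷ # 0 ∷ []) x
stepB x = lookup (# 1 ∷ # 2 ∷ # 3 ∷ # 4 ∷ # 5 ∷ # 6 ∷ # 7 ∷ # 8 ∷ # 4 ∷ []) x

infix 4 _⇝_ _⇝?_

_⇝_ : ColumnType → ColumnType → Set
x ⇝ y = y ≡ stepA x ⊎ y ≡ stepB x

_⇝?_ : ∀ x y → Dec (x ⇝ y)
x ⇝? y = (y ≟ stepA x) ⊎-dec (y ≟ stepB x)

window : (x0 x1 x2 x3 x4 : ColumnType) → Fin 5 → ColumnType
window x0 x1 x2 x3 x4 k = lookup (x0 ∷ x1 ∷ x2 ∷ x3 ∷ x4 ∷ []) k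

centre : Fin 5
centre = # 2

-- Column moves in a window wrap around modulo 5; this is harmless because StarAt only looks at
-- vertices within two moves of the centre column.
module WindowTorus = Torus 5
module Window (W : Fin 5 → ColumnType) = Torus.Coloured 5 W

starAt-window : ∀ x0 x1 → x0 ⇝ x1 → ∀ x2 → x1 ⇝ x2 → ∀ x3 → x2 ⇝ x3 → ∀ x4 → x3 ⇝ x4 →
  ∀ r → Window.StarAt (window x0 x1 x2 x3 x4) (r , centre)
starAt-window = toWitness {a? =
  all? λ x0 → all? λ x1 → x0 ⇝? x1 →-dec all? λ x2 → x1 ⇝? x2 →-dec
  all? λ x3 → x2 ⇝? x3 →-dec all? λ x4 → x3 ⇝? x4 →-dec
  all? λ r → Window.starAt? (window x0 x1 x2 x3 x4) WindowTorus._≟V_ (r , centre)} _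

window-η : ∀ (W : Fin 5 → ColumnType) k → window (W (# 0)) (W (# 1)) (W (# 2)) (W (# 3)) (W (# 4)) k ≡ W k
window-η W zero = refl
window-η W (suc zero) = refl
window-η W (suc (suc zero)) = refl
window-η W (suc (suc (suc zero))) = refl
window-η W (suc (suc (suc (suc zero)))) = refl

module ClosedWalkStar (n : ℕ) .{{_ : NonZero n}} (w : Fin n → ColumnType)
                      (walk : ∀ i → w i ⇝ w (next n i)) where
  open Torus n
  open Coloured w

  walk-prev : ∀ i → w (prev n i) ⇝ w i
  walk-prev i = subst (λ j → w (prev n i) ⇝ w j) (next-prev n i) (walk (prev n i))

  module _ (c : Fin n) where

    offset : Fin 5 → Fin n
    offset k = lookup (prev n (prev n c) ∷ prev n c ∷ c ∷ next n c ∷ next n (next n c) ∷ []) k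

    embed : WindowTorus.Vertex → Vertex
    embed (r , k) = (r , offset k)

    windowAt : Fin 5 → ColumnType
    windowAt k = w (offset k)

    inner : Fin 3 → Fin 5
    inner k = suc (inject₁ k)

    move-embed : ∀ d r k → move d (embed (r , inner k)) ≡ embed (WindowTorus.move d (r , inner k))
    move-embed up    r k                = refl
    move-embed down  r k                = refl
    move-embed right r zero             = cong (r ,_) (next-prev n c)
    move-embed right r (suc zero)       = refl
    move-embed right r (suc (suc zero)) = refl
    move-embed left  r zero             = refl
    move-embed left  r (suc zero)       = refl
    move-embed left  r (suc (suc zero)) = cong (r ,_) (prev-next n c)

    colourOf-embed : ∀ d r k →
      colourOf d (embed (r , inner k)) ≡ Window.colourOf windowAt d (r , inner k)
    colourOf-embed up    r k                = refl
    colourOf-embed down  r k                = refl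
    colourOf-embed right r k                = refl
    colourOf-embed left  r zero             = refl
    colourOf-embed left  r (suc zero)       = refl
    colourOf-embed left  r (suc (suc zero)) = cong (λ i → horizontal (w i) r) (prev-next n c)

    move²-embed : ∀ r d e →
      move e (move d (embed (r , centre))) ≡ embed (WindowTorus.move e (WindowTorus.move d (r , centre)))
    move²-embed r up    e = move-embed e (next 4 r) (# 1)
    move²-embed r down  e = move-embed e (prev 4 r) (# 1)
    move²-embed r right e = move-embed e r (# 2)
    move²-embed r left  e = move-embed e r (# 0)

    colourOf-move-embed : ∀ r d e →
      colourOf e (move d (embed (r , centre))) ≡ Window.colourOf windowAt e (WindowTorus.move d (r , centre))
    colourOf-move-embed r up    e = colourOf-embed e (next 4 r) (# 1)
    colourOf-move-embed r down  e = colourOf-embed e (prev 4 r) (# 1)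
    colourOf-move-embed r right e = colourOf-embed e r (# 2)
    colourOf-move-embed r left  e = colourOf-embed e r (# 0)

    starAt-windowAt : ∀ r → Window.StarAt windowAt (r , centre)
    starAt-windowAt r = starAt-cong 5 (window-η windowAt) (r , centre)
      (starAt-window (windowAt (# 0)) (windowAt (# 1)) (walk-prev (prev n c)) (windowAt (# 2)) (walk-prev c)
        (windowAt (# 3)) (walk c) (windowAt (# 4)) (walk (next n c)) r)

  starAt : ∀ x → StarAt x
  starAt (r , c) = starAt-transfer {moveX = move} {colourOf} {WindowTorus.move} {Window.colourOf (windowAt c)}
    (embed c) (r , centre)
    (λ d → move-embed c d r (# 1)) (move²-embed c r)
    (λ d → colourOf-embed c d r (# 1)) (colourOf-move-embed c r)
    (starAt-windowAt c r)

ClosedWalk : (n : ℕ) → .{{NonZero n}} → Set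
ClosedWalk n = Σ (Fin n → ColumnType) λ w → ∀ i → w i ⇝ w (next n i)

closedWalk⇒starColouring : ∀ n .{{_ : NonZero n}} → 3 ≤ n → ClosedWalk n →
  StarChromaticIndex≤ (C 4 □ C n) 7
closedWalk⇒starColouring n 3≤n (w , walk) = colouring 3≤n , starColouring 3≤n (ClosedWalkStar.starAt n w walk)
  where open Torus.Coloured n w

closedWalk-fromℕ : ∀ n .{{_ : NonZero n}} k → n ≡ suc k → (u : ℕ → ColumnType) →
  (∀ j → u j ⇝ u (suc j)) → u k ⇝ u 0 → ClosedWalk n
closedWalk-fromℕ n k n≡1+k u step back = (λ i → u (toℕ i)) , walk
  where
  walk : ∀ i → u (toℕ i) ⇝ u (toℕ (next n i))
  walk i with suc (toℕ i) <? n
  ... | yes 1+i<n = subst (λ j → u (toℕ i) ⇝ u j)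
                      (sym (trans (toℕ-next n i) (m<n⇒m%n≡m 1+i<n))) (step (toℕ i))
  ... | no 1+i≮n = subst₂ (λ j j′ → u j ⇝ u j′) (sym i≡k) (sym next≡0) back
    where
    1+i≡n : suc (toℕ i) ≡ n
    1+i≡n = ≤-antisym (toℕ<n i) (≮⇒≥ 1+i≮n)
    i≡k : toℕ i ≡ k
    i≡k = suc-injective (trans 1+i≡n n≡1+k)
    next≡0 : toℕ (next n i) ≡ 0
    next≡0 = trans (toℕ-next n i) (trans (cong (_% n) 1+i≡n) (n%n≡0 n))

-- stepB before index s and stepA from then on: for s = 5 and s = 15 the walk is B Aᵃ and B³ Aᵃ.
switchWalk : ℕ → ℕ → ColumnType
switchWalk s zero    = # 4
switchWalk s (suc j) = if s ≤ᵇ suc j then stepA (switchWalk s j) else stepB (switchWalk s j)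

switchWalk-⇝ : ∀ s j → switchWalk s j ⇝ switchWalk s (suc j)
switchWalk-⇝ s j with s ≤ᵇ suc j
... | true  = inj₁ refl
... | false = inj₂ refl

switchWalk-stepA : ∀ {s} j → s ≤ suc j → switchWalk s (suc j) ≡ stepA (switchWalk s j)
switchWalk-stepA {s} j s≤1+j with s ≤ᵇ suc j | ≤⇒≤ᵇ s≤1+j
... | true | _ = refl

stepA⁴-⇝4 : ∀ x → x ⇝ # 4 → stepA (stepA (stepA (stepA x))) ⇝ # 4
stepA⁴-⇝4 = toWitness {a? = all? λ x → x ⇝? # 4 →-dec stepA (stepA (stepA (stepA x))) ⇝? # 4} _

switchWalk-returns : ∀ s a → switchWalk (suc s) s ⇝ # 4 → switchWalk (suc s) (a * 4 + s) ⇝ # 4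
switchWalk-returns s zero    back = back
switchWalk-returns s (suc a) back =
  subst (_⇝ # 4) (sym stepA⁴) (stepA⁴-⇝4 (switchWalk (suc s) j) (switchWalk-returns s a back))
  where
  j = a * 4 + s
  1+s≤1+j : suc s ≤ suc j
  1+s≤1+j = s≤s (m≤n+m s (a * 4))
  stepA⁴ : switchWalk (suc s) (4 + j) ≡ stepA (stepA (stepA (stepA (switchWalk (suc s) j))))
  stepA⁴ = begin
    switchWalk (suc s) (4 + j)                  ≡⟨ switchWalk-stepA (3 + j) (m≤n⇒m≤o+n 3 1+s≤1+j) ⟩
    stepA (switchWalk (suc s) (3 + j))          ≡⟨ cong stepA (switchWalk-stepA (2 + j) (m≤n⇒m≤o+n 2 1+s≤1+j)) ⟩
    stepA (stepA (switchWalk (suc s) (2 + j)))  ≡⟨ cong (stepA ∘ stepA) (switchWalk-stepA (1 + j) (m≤n⇒m≤o+n 1 1+s≤1+j)) ⟩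
    stepA (stepA (stepA (switchWalk (suc s) (1 + j))))
      ≡⟨ cong (stepA ∘ stepA ∘ stepA) (switchWalk-stepA j 1+s≤1+j) ⟩
    stepA (stepA (stepA (stepA (switchWalk (suc s) j)))) ∎
    where open ≡-Reasoning

split-13+o : ∀ o → (13 + o) % 2 ≡ 1 → ∃ λ a → 13 + o ≡ suc (a * 4 + 4) ⊎ 13 + o ≡ suc (a * 4 + 14)
split-13+o 0 _ = 2 , inj₁ refl
split-13+o 1 ()
split-13+o 2 _ = 0 , inj₂ refl
split-13+o 3 ()
split-13+o (suc (suc (suc (suc o)))) odd with split-13+o o odd
... | a , inj₁ eq = suc a , inj₁ (cong (4 +_) eq)
... | a , inj₂ eq = suc a , inj₂ (cong (4 +_) eq)

oddLength-split : ∀ n → n % 2 ≡ 1 → 13 ≤ n → ∃ λ a → n ≡ suc (a * 4 + 4) ⊎ n ≡ suc (a * 4 + 14)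
oddLength-split n odd 13≤n = split (m≤n⇒∃[o]m+o≡n 13≤n)
  where
  split : (∃ λ o → 13 + o ≡ n) → ∃ λ a → n ≡ suc (a * 4 + 4) ⊎ n ≡ suc (a * 4 + 14)
  split (o , refl) = split-13+o o odd

oddClosedWalk : ∀ n .{{_ : NonZero n}} → n % 2 ≡ 1 → 13 ≤ n → ClosedWalk n
oddClosedWalk n odd 13≤n = fromSplit (oddLength-split n odd 13≤n)
  where
  fromSplit : (∃ λ a → n ≡ suc (a * 4 + 4) ⊎ n ≡ suc (a * 4 + 14)) → ClosedWalk n
  fromSplit (a , inj₁ eq) = closedWalk-fromℕ n (a * 4 + 4) eq
    (switchWalk 5) (switchWalk-⇝ 5) (switchWalk-returns 4 a (inj₂ refl))
  fromSplit (a , inj₂ eq) = closedWalk-fromℕ n (a * 4 + 14) eq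
    (switchWalk 15) (switchWalk-⇝ 15) (switchWalk-returns 14 a (inj₂ refl))

theorem15 : (n : ℕ) → .{{_ : NonZero n}} → n % 2 ≡ 1 → 13 ≤ n →
    StarChromaticIndex≤ (C 4 □ C n) 7
theorem15 n odd 13≤n =
  closedWalk⇒starColouring n (≤-trans (s≤s (s≤s (s≤s z≤n))) 13≤n) (oddClosedWalk n odd 13≤n)
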